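{- Let $G=(V,E)$ be a simple 2-vertex-connected outerplanar graph with $V=[n]$, embedded so that the unbounded face $f_\infty$ is the cycle $1\,2\,\cdots\,n\,1$ (indices taken modulo $n$, so $n+1=1$, $0=n$). Let $i,j\in[n]$ with $i\neq j+1$, and let $f$ be a bounded face of $G$. Let $f_1$ and $f_2$ be the unique bounded faces containing the edges $\{i-1,i\}$ and $\{j,j+1\}$, respectively. Then (a) $\delta_G([i,j])=G^*_{f_1,f_2}\cup\{\{i-1,i\},\{j,j+1\}\}$; (b) $\delta_G([i,j])\subseteq G^*_{f_1,f}\cup G^*_{f,f_2}\cup\{\{i-1,i\},\{j,j+1\}\}$; (c) if both $[i,j]$ and $[j+1,i-1]=[n]\setminus[i,j]$ contain a vertex of $f$, then $\delta_G([i,j])=G^*_{f_1,f}\cup G^*_{f,f_2}\cup\{\{i-1,i\},\{j,j+1\}\}$.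
   Context: For $i,j\in[n]$, $[i,j]$ denotes the cyclic interval $\{i,i+1,\dots,j\}$ if $i\le j$ and $\{i,\dots,n,1,\dots,j\}$ if $j<i$. $\delta_G(S)$ is the set of edges of $G$ with exactly one endpoint in $S$. The weak dual $G^*$ has as vertices the bounded faces of $G$, with one edge for each edge $e\in E$ not on $f_\infty$, joining the two bounded faces containing $e$; it is a tree. Each edge of $G^*$ is identified with the corresponding edge of $G$. For bounded faces $f',f''$, $G^*_{f',f''}$ denotes the set of edges (viewed as edges of $G$) of the unique path between $f'$ and $f''$ in $G^*$ (empty if $f'=f''$). -}

module Defs where

open import Data.Nat using (ℕ; zero; suc; _≤_)
open import Data.Nat.Properties using (_≟_)
open import Data.Fin using (Fin; toℕ; fromℕ; inject₁; lower₁) renaming (_<_ to _<ᶠ_; _≤_ to _≤ᶠ_)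
import Data.Fin as F
open import Data.List using (List; []; _∷_; length; head; last; map)
open import Data.List.Relation.Unary.Linked using (Linked)
open import Data.List.Relation.Unary.Any using (Any)
open import Data.List.Relation.Unary.Unique.Propositional using (Unique)
open import Data.List.Membership.Propositional using (_∈_)
open import Data.Empty using (⊥)
open import Data.Maybe using (just)
open import Data.Product using (Σ; _×_; _,_; proj₁; proj₂)
open import Data.Sum using (_⊎_)
open import Relation.Nullary using (¬_; yes; no)
open import Relation.Binary.PropositionalEquality using (_≡_; _≢_)

-- Vertices.  The paper's vertex set [n] = {1,…,n} is represented by
-- Fin n = {0,…,n-1}; paper vertex k corresponds to Fin element k-1.
-- The outer cycle 1 2 ⋯ n 1 becomes 0 1 ⋯ (n-1) 0.

cnext : ∀ {n} → Fin n → Fin n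
cnext {suc m} i with m ≟ toℕ i
... | yes _ = F.zero
... | no ne = F.suc (lower₁ i ne)

cprev : ∀ {n} → Fin n → Fin n
cprev {suc m} F.zero = fromℕ m
cprev {suc m} (F.suc i) = inject₁ i

CycInt : ∀ {n} → Fin n → Fin n → Fin n → Set
CycInt i j v = (i ≤ᶠ j × i ≤ᶠ v × v ≤ᶠ j) ⊎ (j <ᶠ i × (i ≤ᶠ v ⊎ v ≤ᶠ j))

SameEdge : ∀ {n} → Fin n → Fin n → Fin n → Fin n → Set
SameEdge u v a b = (u ≡ a × v ≡ b) ⊎ (u ≡ b × v ≡ a)

-- Hypothesis on G: simple graph on [n], n ≥ 3, whose edges include the
-- cycle 1 2 ⋯ n 1, and which is drawn with this cycle as outer face, i.e.
-- all remaining edges are pairwise non-crossing chords of the n-gon.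
-- (This is exactly a simple 2-connected outerplanar graph embedded with
-- outer face 1 2 ⋯ n 1.)

record OuterplanarCycleEmbedded (n : ℕ) (E : Fin n → Fin n → Set) : Set where
  field
    three≤n  : 3 ≤ n
    sym      : ∀ {u v} → E u v → E v u
    irrefl   : ∀ {u} → ¬ E u u
    outer    : ∀ v → E v (cnext v)
    noCross  : ∀ {a b c d} → E a b → E c d →
               a <ᶠ c → c <ᶠ b → b <ᶠ d → ⊥

data Consec {A : Set} : List A → A → A → Set where
  here  : ∀ {x y xs} → Consec (x ∷ y ∷ xs) x y
  there : ∀ {x xs a b} → Consec xs a b → Consec (x ∷ xs) a b

CycConsec : {A : Set} → List A → A → A → Set
CycConsec xs a b = Consec xs a b ⊎ (last xs ≡ just a × head xs ≡ just b)

module _ {n : ℕ} (E : Fin n → Fin n → Set) where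

  -- A bounded face, given by its boundary vertices in increasing (i.e.
  -- cyclic outer) order: a cycle of G, of length ≥ 3, whose consecutive
  -- vertices are adjacent, and with no further edge (chord) of G among its
  -- vertices.  For a polygon dissection by non-crossing chords these are
  -- exactly the bounded faces.
  record BoundedFace : Set where
    field
      verts    : List (Fin n)
      sorted   : Linked _<ᶠ_ verts
      size     : 3 ≤ length verts
      boundary : ∀ {a b} → CycConsec verts a b → E a b
      noChord  : ∀ {a b} → a ∈ verts → b ∈ verts → E a b →
                 CycConsec verts a b ⊎ CycConsec verts b a
  open BoundedFace public

  FaceHasEdge : BoundedFace → Fin n → Fin n → Set
  FaceHasEdge f a b = CycConsec (verts f) a b ⊎ CycConsec (verts f) b a

  InnerEdge : Fin n → Fin n → Set
  InnerEdge a b = E a b × b ≢ cnext a × a ≢ cnext b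

  -- an edge of the weak dual G*: the inner edge {a,b} joining the two
  -- distinct bounded faces f and g which contain it
  record DualEdge (f g : BoundedFace) : Set where
    field
      ea ebb  : Fin n
      inner   : InnerEdge ea ebb
      distinct : verts f ≢ verts g
      inF     : FaceHasEdge f ea ebb
      inG     : FaceHasEdge g ea ebb
  open DualEdge public

  data DualWalk : BoundedFace → BoundedFace → Set where
    []  : ∀ {f} → DualWalk f f
    _∷_ : ∀ {f g h} → DualEdge f g → DualWalk g h → DualWalk f h

  walkFaces : ∀ {f g} → DualWalk f g → List BoundedFace
  walkFaces {f} [] = f ∷ []
  walkFaces {f} (_ ∷ w) = f ∷ walkFaces w

  IsPath : ∀ {f g} → DualWalk f g → Set
  IsPath w = Unique (map verts (walkFaces w))

  OnWalk : ∀ {f g} → DualWalk f g → Fin n → Fin n → Set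
  OnWalk [] u v = ⊥
  OnWalk (d ∷ w) u v = SameEdge u v (ea d) (ebb d) ⊎ OnWalk w u v

  InCut : (Fin n → Set) → Fin n → Fin n → Set
  InCut S u v = E u v × ((S u × ¬ S v) ⊎ (S v × ¬ S u))

{-# OPTIONS --safe #-}
-- Vertices are 0, …, n-1 in the order of the outer cycle, so every inner edge is a chord c < d.
-- Since chords do not cross, every bounded face lies on one side of each chord {c, d}: all its
-- vertices in [c, d] or all outside (c, d); and a face through the chord is determined by its side.
-- Hence a dual edge flips the side of its own chord and of no other, so a chord lies on the dual path
-- between two faces iff it separates them.  The face at the outer edge {w, w+1} is inside {c, d} iff
-- c < w+1 ≤ d.  Writing v ∈ [i, j] as the parity [i ≤ v] ⊕ [j+1 ≤ v] ⊕ [j+1 ≤ i], a chord is cut by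
-- [i, j] iff exactly one of the thresholds i, j+1 lies in (c, d], i.e. iff it separates f₁ from f₂;
-- this is (a), the only cut outer edges being {i-1, i} and {j, j+1}.  For (b), a chord separating f₁
-- from f₂ separates f from one of them.  For (c), a chord separating f from f₁ but not f₁ from f₂
-- would put all of f on one side of the cut.
module Submission where

open import Defs
open import Data.Nat using (ℕ; zero; suc; _<_; _≤_; z≤n; s≤s; _≤?_; _≤ᵇ_)
open import Data.Nat.Properties
open import Data.Fin using (Fin; toℕ) renaming (_<_ to _<ᶠ_; _≤_ to _≤ᶠ_)
import Data.Fin as F
open import Data.Fin.Properties using (toℕ-injective; toℕ<n; toℕ-inject₁; toℕ-lower₁; toℕ-fromℕ)
open import Data.Bool using (Bool; true; false; not; _xor_)
open import Data.Bool.Properties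
  using (xor-∧-commutativeRing; xor-same; xor-identityʳ; xor-comm; xor-inverseˡ; not-distribʳ-xor;
         not-¬; ¬-not; not-injective)
  renaming (_≟_ to _≟ᵇ_)
open import Algebra.Bundles using (CommutativeRing; CommutativeMonoid)
import Algebra.Properties.CommutativeSemigroup as CommutativeSemigroupProperties
open import Data.Empty using (⊥; ⊥-elim)
open import Data.Product using (Σ; ∃; ∃₂; _×_; _,_; proj₁; proj₂; swap)
open import Data.Sum using (_⊎_; inj₁; inj₂; [_,_])
import Data.Sum
open import Data.List using (List; []; _∷_; length; head; last; map)
open import Data.List.Relation.Unary.Linked using (Linked; []; [-]; _∷_)
open import Data.List.Relation.Unary.Linked.Properties using (Linked⇒AllPairs)
open import Data.List.Relation.Unary.AllPairs using (_∷_)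
import Data.List.Relation.Unary.All as All
open import Data.List.Relation.Unary.Any using (any?; here; there)
open import Data.List.Membership.Propositional using (_∈_; _∉_; find; lose)
open import Data.Maybe using (just)
open import Function.Base using (_∘′_)
open import Function.Bundles using (_⇔_; mk⇔; Equivalence)
open Equivalence using (to; from)
open import Relation.Nullary using (¬_; Dec; yes; no; does; contradiction)
open import Relation.Nullary.Decidable using (_×-dec_; _⊎-dec_; dec-true; dec-false)
open import Relation.Nullary.Reflects using (ofʸ; ofⁿ)
open import Relation.Binary.Definitions using (tri<; tri≈; tri>)
open import Relation.Binary.PropositionalEquality
  using (_≡_; _≢_; refl; sym; trans; cong; cong₂; subst; module ≡-Reasoning)

open CommutativeSemigroupProperties
  (CommutativeMonoid.commutativeSemigroup (CommutativeRing.+-commutativeMonoid xor-∧-commutativeRing))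
  using (interchange; x∙yz≈y∙xz)

xor≡true-cases : ∀ {a b} → a xor b ≡ true → a ≡ true ⊎ b ≡ true
xor≡true-cases {true} _ = inj₁ refl
xor≡true-cases {false} e = inj₂ e

xor≡false⇒≡ : ∀ {a b} → a xor b ≡ false → a ≡ b
xor≡false⇒≡ {false} e = sym e
xor≡false⇒≡ {true} {true} _ = refl

xor≢true⇒≡ : ∀ {a b} → a xor b ≢ true → a ≡ b
xor≢true⇒≡ ne = xor≡false⇒≡ (¬-not ne)

xor≡true⇒≢ : ∀ {a b} → a xor b ≡ true → a ≢ b
xor≡true⇒≢ {a} e refl = contradiction (trans (sym e) (xor-same a)) λ ()

xor-split : ∀ {a b} c → a xor b ≡ true → a xor c ≡ true ⊎ c xor b ≡ true
xor-split {true} true e = inj₂ e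
xor-split {true} false _ = inj₁ refl
xor-split {false} true _ = inj₁ refl
xor-split {false} false e = inj₂ e

does-true⇒ : ∀ {P : Set} (p? : Dec P) → does p? ≡ true → P
does-true⇒ (yes p) _ = p

does-false⇒ : ∀ {P : Set} (p? : Dec P) → does p? ≡ false → ¬ P
does-false⇒ (no ¬p) _ = ¬p

-- Threshold crossings

≤ᵇ-true : ∀ {m k} → m ≤ k → (m ≤ᵇ k) ≡ true
≤ᵇ-true {m} {k} = dec-true (m ≤? k)

≤ᵇ-false : ∀ {m k} → k < m → (m ≤ᵇ k) ≡ false
≤ᵇ-false {m} {k} k<m = dec-false (m ≤? k) (<⇒≱ k<m)

≤ᵇ-flip : ∀ {m k} → m ≢ k → (m ≤ᵇ k) ≡ not (k ≤ᵇ m)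
≤ᵇ-flip {m} {k} m≢k with <-cmp m k
... | tri< m<k _ _ rewrite ≤ᵇ-true (<⇒≤ m<k) | ≤ᵇ-false m<k = refl
... | tri≈ _ m≡k _ = contradiction m≡k m≢k
... | tri> _ _ k<m rewrite ≤ᵇ-false k<m | ≤ᵇ-true (<⇒≤ k<m) = refl

crosses : ℕ → ℕ → ℕ → Bool
crosses t x y = (t ≤ᵇ x) xor (t ≤ᵇ y)

crosses-sym : ∀ t x y → crosses t x y ≡ crosses t y x
crosses-sym t x y = xor-comm (t ≤ᵇ x) (t ≤ᵇ y)

crosses-true : ∀ {t x y} → x < t → t ≤ y → crosses t x y ≡ true
crosses-true x<t t≤y rewrite ≤ᵇ-false x<t | ≤ᵇ-true t≤y = refl

crosses-false-≤ : ∀ {t x y} → t ≤ x → x ≤ y → crosses t x y ≡ false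
crosses-false-≤ t≤x x≤y rewrite ≤ᵇ-true t≤x | ≤ᵇ-true (≤-trans t≤x x≤y) = refl

crosses-false-> : ∀ {t x y} → y < t → x ≤ y → crosses t x y ≡ false
crosses-false-> y<t x≤y rewrite ≤ᵇ-false y<t | ≤ᵇ-false (≤-<-trans x≤y y<t) = refl

crosses-true⇒ : ∀ {t x y} → x ≤ y → crosses t x y ≡ true → x < t × t ≤ y
crosses-true⇒ x≤y e =
  ≰⇒> (λ t≤x → contradiction (trans (sym e) (crosses-false-≤ t≤x x≤y)) λ ()) ,
  ≮⇒≥ (λ y<t → contradiction (trans (sym e) (crosses-false-> y<t x≤y)) λ ())

crosses-step : ∀ {t x} → crosses t x (suc x) ≡ true → t ≡ suc x
crosses-step {x = x} e = let x<t , t≤sx = crosses-true⇒ (n≤1+n x) e in ≤-antisym t≤sx x<t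

crosses-false-within : ∀ {t c d x y} → crosses t c d ≡ false → c ≤ x → x ≤ y → y ≤ d → crosses t x y ≡ false
crosses-false-within {t} e c≤x x≤y y≤d = ¬-not λ crosses-xy →
  let x<t , t≤y = crosses-true⇒ {t} x≤y crosses-xy
  in contradiction (trans (sym e) (crosses-true {t} (≤-<-trans c≤x x<t) (≤-trans t≤y y≤d))) λ ()

≤ᵇ-outside : ∀ {t c d z} → c < t → t ≤ d → z ≤ c ⊎ d ≤ z → (t ≤ᵇ z) ≡ (d ≤ᵇ z)
≤ᵇ-outside c<t t≤d (inj₁ z≤c) =
  let z<t = ≤-<-trans z≤c c<t in trans (≤ᵇ-false z<t) (sym (≤ᵇ-false (<-≤-trans z<t t≤d)))
≤ᵇ-outside c<t t≤d (inj₂ d≤z) = trans (≤ᵇ-true (≤-trans t≤d d≤z)) (sym (≤ᵇ-true d≤z))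

crosses-outside : ∀ {t c d x y} → c < t → t ≤ d → x ≤ c ⊎ d ≤ x → y ≤ c ⊎ d ≤ y →
  crosses t x y ≡ crosses d x y
crosses-outside c<t t≤d x-out y-out = cong₂ _xor_ (≤ᵇ-outside c<t t≤d x-out) (≤ᵇ-outside c<t t≤d y-out)

-- v ∈ [a, b) on the cycle, as the parity of three threshold tests (meaningful for a ≠ b)
inArcᵇ : ℕ → ℕ → ℕ → Bool
inArcᵇ a b v = (a ≤ᵇ v) xor (b ≤ᵇ v) xor (b ≤ᵇ a)

inArcᵇ-xor : ∀ a b x y → inArcᵇ a b x xor inArcᵇ a b y ≡ crosses a x y xor crosses b x y
inArcᵇ-xor a b x y = begin
  (p xor q xor k) xor (p′ xor q′ xor k)       ≡⟨ interchange p (q xor k) p′ (q′ xor k) ⟩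
  (p xor p′) xor ((q xor k) xor (q′ xor k))   ≡⟨ cong ((p xor p′) xor_) (interchange q k q′ k) ⟩
  (p xor p′) xor ((q xor q′) xor (k xor k))   ≡⟨ cong (λ z → (p xor p′) xor (q xor q′) xor z) (xor-same k) ⟩
  (p xor p′) xor ((q xor q′) xor false)       ≡⟨ cong ((p xor p′) xor_) (xor-identityʳ (q xor q′)) ⟩
  (p xor p′) xor (q xor q′)                   ∎
  where
  open ≡-Reasoning
  p = a ≤ᵇ x ; p′ = a ≤ᵇ y ; q = b ≤ᵇ x ; q′ = b ≤ᵇ y ; k = b ≤ᵇ a

inArcᵇ-flip : ∀ {a b} v → a ≢ b → inArcᵇ b a v ≡ not (inArcᵇ a b v)
inArcᵇ-flip {a} {b} v a≢b = begin
  (b ≤ᵇ v) xor (a ≤ᵇ v) xor (a ≤ᵇ b)         ≡⟨ cong (λ z → (b ≤ᵇ v) xor (a ≤ᵇ v) xor z) (≤ᵇ-flip a≢b) ⟩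
  (b ≤ᵇ v) xor (a ≤ᵇ v) xor not (b ≤ᵇ a)     ≡⟨ cong ((b ≤ᵇ v) xor_) (sym (not-distribʳ-xor (a ≤ᵇ v) (b ≤ᵇ a))) ⟩
  (b ≤ᵇ v) xor not ((a ≤ᵇ v) xor (b ≤ᵇ a))   ≡⟨ sym (not-distribʳ-xor (b ≤ᵇ v) _) ⟩
  not ((b ≤ᵇ v) xor (a ≤ᵇ v) xor (b ≤ᵇ a))   ≡⟨ cong not (x∙yz≈y∙xz (b ≤ᵇ v) (a ≤ᵇ v) (b ≤ᵇ a)) ⟩
  not (inArcᵇ a b v)                         ∎
  where open ≡-Reasoning

inArcᵇ-0ˡ : ∀ {m b v} → v < m → 0 < b → b ≤ m → inArcᵇ 0 b v ≡ inArcᵇ m b v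
inArcᵇ-0ˡ {m} {suc b} {v} v<m _ b≤m rewrite ≤ᵇ-false v<m | ≤ᵇ-true b≤m with suc b ≤ᵇ v
... | true = refl
... | false = refl

inArcᵇ-0ʳ : ∀ {m a v} → v < m → a < m → inArcᵇ a 0 v ≡ inArcᵇ a m v
inArcᵇ-0ʳ v<m a<m rewrite ≤ᵇ-false v<m | ≤ᵇ-false a<m = refl

-- Cyclic intervals of Fin n

cnext-view : ∀ {n} (u : Fin n) →
  (toℕ (cnext u) ≡ suc (toℕ u) × suc (toℕ u) < n) ⊎ (toℕ (cnext u) ≡ 0 × suc (toℕ u) ≡ n)
cnext-view {suc m} u with m ≟ toℕ u
... | yes m≡u = inj₂ (refl , cong suc (sym m≡u))
... | no m≢u = inj₁ (cong suc (toℕ-lower₁ u m≢u) , s≤s (≤∧≢⇒< (≤-pred (toℕ<n u)) (λ u≡m → m≢u (sym u≡m))))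

cprev-view : ∀ {n} (u : Fin n) →
  suc (toℕ (cprev u)) ≡ toℕ u ⊎ (toℕ u ≡ 0 × suc (toℕ (cprev u)) ≡ n)
cprev-view {suc m} F.zero = inj₂ (refl , cong suc (toℕ-fromℕ m))
cprev-view {suc m} (F.suc u) = inj₁ (cong suc (toℕ-inject₁ u))

cnext-cprev : ∀ {n} (u : Fin n) → cnext (cprev u) ≡ u
cnext-cprev u with cnext-view (cprev u) | cprev-view u
... | inj₁ (e , _) | inj₁ e′ = toℕ-injective (trans e e′)
... | inj₁ (_ , <n) | inj₂ (_ , ≡n) = contradiction ≡n (<⇒≢ <n)
... | inj₂ (_ , ≡n) | inj₁ e′ = contradiction (trans (sym e′) ≡n) (<⇒≢ (toℕ<n u))
... | inj₂ (e , _) | inj₂ (u≡0 , _) = toℕ-injective (trans e (sym u≡0))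

cycIntᵇ : ∀ {n} → Fin n → Fin n → Fin n → Bool
cycIntᵇ i j v = inArcᵇ (toℕ i) (suc (toℕ j)) (toℕ v)

cycIntᵇ-xor : ∀ {n} (i j x y : Fin n) → cycIntᵇ i j x xor cycIntᵇ i j y ≡
  crosses (toℕ i) (toℕ x) (toℕ y) xor crosses (suc (toℕ j)) (toℕ x) (toℕ y)
cycIntᵇ-xor i j x y = inArcᵇ-xor (toℕ i) (suc (toℕ j)) (toℕ x) (toℕ y)

cycInt⇒cycIntᵇ : ∀ {n} {i j v : Fin n} → CycInt i j v → cycIntᵇ i j v ≡ true
cycInt⇒cycIntᵇ (inj₁ (i≤j , i≤v , v≤j))
  rewrite ≤ᵇ-true i≤v | ≤ᵇ-false (s≤s v≤j) | ≤ᵇ-false (s≤s i≤j) = refl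
cycInt⇒cycIntᵇ (inj₂ (j<i , inj₁ i≤v))
  rewrite ≤ᵇ-true i≤v | ≤ᵇ-true (≤-trans j<i i≤v) | ≤ᵇ-true j<i = refl
cycInt⇒cycIntᵇ (inj₂ (j<i , inj₂ v≤j))
  rewrite ≤ᵇ-false (≤-<-trans v≤j j<i) | ≤ᵇ-false (s≤s v≤j) | ≤ᵇ-true j<i = refl

cycIntᵇ⇒cycInt : ∀ {n} {i j v : Fin n} → cycIntᵇ i j v ≡ true → CycInt i j v
cycIntᵇ⇒cycInt {i = i} {j} {v} e
  with toℕ i ≤ᵇ toℕ v | ≤ᵇ-reflects-≤ (toℕ i) (toℕ v)
     | suc (toℕ j) ≤ᵇ toℕ v | ≤ᵇ-reflects-≤ (suc (toℕ j)) (toℕ v)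
     | suc (toℕ j) ≤ᵇ toℕ i | ≤ᵇ-reflects-≤ (suc (toℕ j)) (toℕ i)
cycIntᵇ⇒cycInt e | true | ofʸ i≤v | _ | _ | true | ofʸ j<i = inj₂ (j<i , inj₁ i≤v)
cycIntᵇ⇒cycInt e | false | _ | false | ofⁿ j≮v | true | ofʸ j<i = inj₂ (j<i , inj₂ (≤-pred (≰⇒> j≮v)))
cycIntᵇ⇒cycInt e | true | ofʸ i≤v | false | ofⁿ j≮v | false | ofⁿ j≮i =
  inj₁ (≤-pred (≰⇒> j≮i) , i≤v , ≤-pred (≰⇒> j≮v))
cycIntᵇ⇒cycInt e | false | ofⁿ i≰v | true | ofʸ j<v | false | ofⁿ j≮i =
  contradiction (≤-trans (≤-pred (≰⇒> j≮i)) (<⇒≤ j<v)) i≰v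
cycIntᵇ⇒cycInt () | false | _ | true | _ | true | _
cycIntᵇ⇒cycInt () | true | _ | true | _ | false | _
cycIntᵇ⇒cycInt () | false | _ | false | _ | false | _

cycInt-start : ∀ {n} (a b : Fin n) → CycInt a b a
cycInt-start a b with toℕ a ≤? toℕ b
... | yes a≤b = inj₁ (a≤b , ≤-refl , a≤b)
... | no a≰b = inj₂ (≰⇒> a≰b , inj₁ ≤-refl)

cycInt-end : ∀ {n} (a b : Fin n) → CycInt a b b
cycInt-end a b with toℕ a ≤? toℕ b
... | yes a≤b = inj₁ (a≤b , a≤b , ≤-refl)
... | no a≰b = inj₂ (≰⇒> a≰b , inj₂ ≤-refl)

cycIntᵇ-complement : ∀ {n} {i j : Fin n} y → i ≢ cnext j → cycIntᵇ (cnext j) (cprev i) y ≡ not (cycIntᵇ i j y)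
cycIntᵇ-complement {n} {i} {j} y i≢j+1 with cnext-view j | cprev-view i
... | inj₁ (j+1≡ , _) | inj₁ i≡ = begin
  inArcᵇ (toℕ (cnext j)) (suc (toℕ (cprev i))) Y  ≡⟨ cong₂ (λ a b → inArcᵇ a b Y) j+1≡ i≡ ⟩
  inArcᵇ (suc (toℕ j)) (toℕ i) Y                  ≡⟨ inArcᵇ-flip Y (λ e → i≢j+1 (toℕ-injective (trans e (sym j+1≡)))) ⟩
  not (cycIntᵇ i j y)                             ∎
  where open ≡-Reasoning ; Y = toℕ y
... | inj₂ (j+1≡0 , j+1≡n) | inj₁ i≡ = begin
  inArcᵇ (toℕ (cnext j)) (suc (toℕ (cprev i))) Y  ≡⟨ cong₂ (λ a b → inArcᵇ a b Y) j+1≡0 i≡ ⟩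
  inArcᵇ 0 (toℕ i) Y                              ≡⟨ inArcᵇ-0ˡ (toℕ<n y) (subst (0 <_) i≡ (s≤s z≤n)) (<⇒≤ (toℕ<n i)) ⟩
  inArcᵇ n (toℕ i) Y                              ≡⟨ inArcᵇ-flip Y (<⇒≢ (toℕ<n i)) ⟩
  not (inArcᵇ (toℕ i) n Y)                        ≡⟨ cong (λ b → not (inArcᵇ (toℕ i) b Y)) (sym j+1≡n) ⟩
  not (cycIntᵇ i j y)                             ∎
  where open ≡-Reasoning ; Y = toℕ y
... | inj₁ (j+1≡ , j+1<n) | inj₂ (i≡0 , i≡n) = begin
  inArcᵇ (toℕ (cnext j)) (suc (toℕ (cprev i))) Y  ≡⟨ cong₂ (λ a b → inArcᵇ a b Y) j+1≡ i≡n ⟩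
  inArcᵇ (suc (toℕ j)) n Y                        ≡⟨ sym (inArcᵇ-0ʳ (toℕ<n y) j+1<n) ⟩
  inArcᵇ (suc (toℕ j)) 0 Y                        ≡⟨ inArcᵇ-flip {0} {suc (toℕ j)} Y (λ ()) ⟩
  not (inArcᵇ 0 (suc (toℕ j)) Y)                  ≡⟨ cong (λ a → not (inArcᵇ a (suc (toℕ j)) Y)) (sym i≡0) ⟩
  not (cycIntᵇ i j y)                             ∎
  where open ≡-Reasoning ; Y = toℕ y
... | inj₂ (j+1≡0 , _) | inj₂ (i≡0 , _) = contradiction (toℕ-injective (trans i≡0 (sym j+1≡0))) i≢j+1

cycInt-disjoint : ∀ {n} {i j y : Fin n} → i ≢ cnext j → CycInt (cnext j) (cprev i) y → ¬ CycInt i j y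
cycInt-disjoint {y = y} i≢j+1 y∈ y∈′ =
  not-¬ (sym (cycInt⇒cycIntᵇ y∈′)) (trans (sym (cycInt⇒cycIntᵇ y∈)) (cycIntᵇ-complement y i≢j+1))

cycIntᵇ-step : ∀ {n} (i j u : Fin n) → cycIntᵇ i j u xor cycIntᵇ i j (cnext u) ≡ true → u ≡ cprev i ⊎ u ≡ j
cycIntᵇ-step i j u e
  with toℕ (cnext u) | cnext-view u | trans (sym (cycIntᵇ-xor i j u (cnext u))) e | cprev-view i
... | _ | inj₁ (refl , _) | crossing | i-view with xor≡true-cases {crosses (toℕ i) (toℕ u) (suc (toℕ u))} crossing
...   | inj₂ crosses-j = inj₂ (toℕ-injective (suc-injective (sym (crosses-step {suc (toℕ j)} crosses-j))))
...   | inj₁ crosses-i with i-view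
...     | inj₁ i≡ = inj₁ (toℕ-injective (suc-injective (trans (sym (crosses-step {toℕ i} crosses-i)) (sym i≡))))
...     | inj₂ (i≡0 , _) with () ← trans (sym i≡0) (crosses-step {toℕ i} crosses-i)
cycIntᵇ-step i j u e | _ | inj₂ (refl , u+1≡n) | _ | inj₂ (_ , i-1+1≡n) =
  inj₁ (toℕ-injective (suc-injective (trans u+1≡n (sym i-1+1≡n))))
cycIntᵇ-step i j u e | _ | inj₂ (refl , u+1≡n) | crossing | inj₁ i≡ =
  inj₂ (toℕ-injective (≤-antisym (≮⇒≥ j≮u) (≤-pred (subst (suc (toℕ j) ≤_) (sym u+1≡n) (toℕ<n j)))))
  where
  -- u = n - 1 and i ≠ 0, so the step between u and 0 crosses i, hence not j + 1
  crosses-i : crosses (toℕ i) (toℕ u) 0 ≡ true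
  crosses-i = trans (crosses-sym (toℕ i) (toℕ u) 0)
                    (crosses-true (subst (0 <_) i≡ (s≤s z≤n)) (≤-pred (subst (toℕ i <_) (sym u+1≡n) (toℕ<n i))))
  j≮u : ¬ toℕ j < toℕ u
  j≮u j<u = contradiction (trans (sym crossing) (cong₂ _xor_ crosses-i crosses-j)) λ ()
    where crosses-j = trans (crosses-sym (suc (toℕ j)) (toℕ u) 0) (crosses-true (s≤s z≤n) j<u)

SameEdge-resp : ∀ {n} (P : Fin n → Fin n → Set) → (∀ {a b} → P a b → P b a) →
  ∀ {u v a b} → SameEdge u v a b → P a b → P u v
SameEdge-resp P P-sym (inj₁ (refl , refl)) p = p
SameEdge-resp P P-sym (inj₂ (refl , refl)) p = P-sym p

SameEdge-swap : ∀ {n} {u v a b : Fin n} → SameEdge u v a b → SameEdge v u a b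
SameEdge-swap (inj₁ (u≡a , v≡b)) = inj₂ (v≡b , u≡a)
SameEdge-swap (inj₂ (u≡b , v≡a)) = inj₁ (v≡a , u≡b)

endpoints⇒SameEdge : ∀ {n} {u v a b : Fin n} → a ≡ u ⊎ a ≡ v → b ≡ u ⊎ b ≡ v → a ≢ b → SameEdge u v a b
endpoints⇒SameEdge (inj₁ refl) (inj₁ refl) a≢b = contradiction refl a≢b
endpoints⇒SameEdge (inj₁ refl) (inj₂ refl) _ = inj₁ (refl , refl)
endpoints⇒SameEdge (inj₂ refl) (inj₁ refl) _ = inj₂ (refl , refl)
endpoints⇒SameEdge (inj₂ refl) (inj₂ refl) a≢b = contradiction refl a≢b

SameEdge-ordered : ∀ {n} {u v a b : Fin n} → u <ᶠ v → a <ᶠ b → SameEdge u v a b → u ≡ a × v ≡ b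
SameEdge-ordered _ _ (inj₁ u≡a×v≡b) = u≡a×v≡b
SameEdge-ordered u<v a<b (inj₂ (refl , refl)) = contradiction u<v (<-asym a<b)

-- Sorted vertex lists

module _ {n : ℕ} where

  Sorted : List (Fin n) → Set
  Sorted = Linked _<ᶠ_

  consec⇒∈ : ∀ {xs : List (Fin n)} {a b} → Consec xs a b → a ∈ xs × b ∈ xs
  consec⇒∈ here = here refl , there (here refl)
  consec⇒∈ (there c) = let a∈ , b∈ = consec⇒∈ c in there a∈ , there b∈

  head⇒∈ : ∀ {xs : List (Fin n)} {a} → head xs ≡ just a → a ∈ xs
  head⇒∈ {_ ∷ _} refl = here refl

  last⇒∈ : ∀ {xs : List (Fin n)} {a} → last xs ≡ just a → a ∈ xs
  last⇒∈ {_ ∷ []} refl = here refl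
  last⇒∈ {_ ∷ y ∷ ys} e = there (last⇒∈ {y ∷ ys} e)

  cycConsec⇒∈ : ∀ {xs : List (Fin n)} {a b} → CycConsec xs a b → a ∈ xs × b ∈ xs
  cycConsec⇒∈ (inj₁ c) = consec⇒∈ c
  cycConsec⇒∈ (inj₂ (l , h)) = last⇒∈ l , head⇒∈ h

  head<tail : ∀ {x y : Fin n} {xs} → Sorted (x ∷ xs) → y ∈ xs → x <ᶠ y
  head<tail s y∈ with Linked⇒AllPairs (λ {i} {j} {k} → <-trans {toℕ i} {toℕ j} {toℕ k}) s
  ... | x<xs ∷ _ = All.lookup x<xs y∈

  head≤ : ∀ {xs : List (Fin n)} {h y} → Sorted xs → head xs ≡ just h → y ∈ xs → h ≤ᶠ y
  head≤ {_ ∷ _} s refl (here refl) = ≤-refl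
  head≤ {_ ∷ _} s refl (there y∈) = <⇒≤ (head<tail s y∈)

  ≤last : ∀ {xs : List (Fin n)} {l y} → Sorted xs → last xs ≡ just l → y ∈ xs → y ≤ᶠ l
  ≤last {_ ∷ []} s refl (here refl) = ≤-refl
  ≤last {_ ∷ _ ∷ _} s@(_ ∷ s′) e (here refl) = <⇒≤ (head<tail s (last⇒∈ e))
  ≤last {_ ∷ _ ∷ _} (_ ∷ s′) e (there y∈) = ≤last s′ e y∈

  consec⇒< : ∀ {xs : List (Fin n)} {a b} → Sorted xs → Consec xs a b → a <ᶠ b
  consec⇒< (a<b ∷ _) here = a<b
  consec⇒< (_ ∷ s) (there c) = consec⇒< s c
  consec⇒< [-] (there ())

  consec-gap : ∀ {xs : List (Fin n)} {a b y} → Sorted xs → Consec xs a b → y ∈ xs →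
               y ≤ᶠ a ⊎ b ≤ᶠ y
  consec-gap s here (here refl) = inj₁ ≤-refl
  consec-gap (_ ∷ s) here (there y∈) = inj₂ (head≤ s refl y∈)
  consec-gap s (there c) (here refl) = inj₁ (<⇒≤ (head<tail s (proj₁ (consec⇒∈ c))))
  consec-gap (_ ∷ s) (there c) (there y∈) = consec-gap s c y∈
  consec-gap [-] (there ()) _

  consec-straddling : ∀ {xs : List (Fin n)} {x y t} → Sorted xs → x ∈ xs → y ∈ xs →
    toℕ x < t → t ≤ toℕ y → ∃₂ λ a b → Consec xs a b × toℕ a < t × t ≤ toℕ b
  consec-straddling {_ ∷ []} _ (here refl) (here refl) x<t t≤y = contradiction x<t (≤⇒≯ t≤y)
  consec-straddling {a ∷ b ∷ _} {t = t} s@(_ ∷ s′) x∈ y∈ x<t t≤y with t ≤? toℕ b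
  ... | yes t≤b = a , b , here , ≤-<-trans (head≤ s refl x∈) x<t , t≤b
  ... | no t≰b with y∈
  ...   | here refl = contradiction (≤-<-trans (head≤ s refl x∈) x<t) (≤⇒≯ t≤y)
  ...   | there y∈′ =
          let a′ , b′ , c , a′<t , t≤b′ = consec-straddling s′ (here refl) y∈′ (≰⇒> t≰b) t≤y
          in a′ , b′ , there c , a′<t , t≤b′

  sorted-ext : ∀ {xs ys : List (Fin n)} → Sorted xs → Sorted ys →
    (∀ {x} → x ∈ xs → x ∈ ys) → (∀ {x} → x ∈ ys → x ∈ xs) → xs ≡ ys
  sorted-ext {[]} {[]} _ _ _ _ = refl
  sorted-ext {[]} {_ ∷ _} _ _ _ ys⊆ with () ← ys⊆ (here refl)
  sorted-ext {_ ∷ _} {[]} _ _ xs⊆ _ with () ← xs⊆ (here refl)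
  sorted-ext {x ∷ xs} {y ∷ ys} sx sy xs⊆ ys⊆ = cong₂ _∷_ x≡y (sorted-ext (tail sx) (tail sy) xs⊆′ ys⊆′)
    where
    tail : ∀ {z : Fin n} {zs} → Sorted (z ∷ zs) → Sorted zs
    tail [-] = []
    tail (_ ∷ s) = s
    x≡y : x ≡ y
    x≡y = toℕ-injective (≤-antisym (head≤ sx refl (ys⊆ (here refl))) (head≤ sy refl (xs⊆ (here refl))))
    xs⊆′ : ∀ {z} → z ∈ xs → z ∈ ys
    xs⊆′ z∈ with xs⊆ (there z∈)
    ... | here refl = contradiction (cong toℕ x≡y) (<⇒≢ (head<tail sx z∈))
    ... | there z∈′ = z∈′
    ys⊆′ : ∀ {z} → z ∈ ys → z ∈ xs
    ys⊆′ z∈ with ys⊆ (there z∈)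
    ... | here refl = contradiction (cong toℕ (sym x≡y)) (<⇒≢ (head<tail sy z∈))
    ... | there z∈′ = z∈′

  third-element : ∀ {xs : List (Fin n)} → 3 ≤ length xs → Sorted xs → ∀ (c d : Fin n) →
    ∃ λ v → v ∈ xs × v ≢ c × v ≢ d
  third-element {_ ∷ []} (s≤s ()) _ _ _
  third-element {_ ∷ _ ∷ []} (s≤s (s≤s ())) _ _ _
  third-element {a ∷ b ∷ e ∷ _} _ (a<b ∷ b<e ∷ _) c d with (a F.≟ c) ⊎-dec (a F.≟ d) | (b F.≟ c) ⊎-dec (b F.≟ d)
  ... | no a∉ | _ = a , here refl , (λ a≡c → a∉ (inj₁ a≡c)) , (λ a≡d → a∉ (inj₂ a≡d))
  ... | yes _ | no b∉ = b , there (here refl) , (λ b≡c → b∉ (inj₁ b≡c)) , (λ b≡d → b∉ (inj₂ b≡d))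
  ... | yes a∈ | yes b∈ = e , there (there (here refl)) , e≢ a∈ b∈ , e≢ (Data.Sum.swap a∈) (Data.Sum.swap b∈)
    where
    a<e = <-trans a<b b<e
    -- if e were one of c, d, then a and b would both be the other one
    e≢ : ∀ {p q} → a ≡ p ⊎ a ≡ q → b ≡ p ⊎ b ≡ q → e ≢ p
    e≢ (inj₁ refl) _ refl = <-irrefl refl a<e
    e≢ _ (inj₁ refl) refl = <-irrefl refl b<e
    e≢ (inj₂ refl) (inj₂ refl) _ = <-irrefl refl a<b

  ends : ∀ {xs : List (Fin n)} → 2 ≤ length xs → Sorted xs →
    ∃₂ λ h l → head xs ≡ just h × last xs ≡ just l × h <ᶠ l
  ends {_ ∷ []} (s≤s ()) _
  ends {x ∷ y ∷ ys} _ s = x , proj₁ (lastOf y ys) , refl , proj₂ (lastOf y ys) ,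
                           head<tail s (last⇒∈ (proj₂ (lastOf y ys)))
    where
    lastOf : ∀ (z : Fin n) zs → ∃ λ l → last (z ∷ zs) ≡ just l
    lastOf z [] = z , refl
    lastOf _ (z ∷ zs) = lastOf z zs

-- Faces of a polygon dissection by non-crossing chords

module Dissection {n : ℕ} {E : Fin n → Fin n → Set} (G : OuterplanarCycleEmbedded n E) where
  open OuterplanarCycleEmbedded G renaming (sym to E-sym)
  open import Data.List.Membership.DecPropositional (F._≟_ {n}) using (_∈?_)

  Face : Set
  Face = BoundedFace E

  Inside Outside : Fin n → Fin n → Fin n → Set
  Inside c d v = c <ᶠ v × v <ᶠ d
  Outside c d v = v <ᶠ c ⊎ d <ᶠ v

  OnSide : Bool → Fin n → Fin n → Fin n → Set
  OnSide true = Inside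
  OnSide false = Outside

  position : ∀ (c d v : Fin n) → (∃ λ s → OnSide s c d v) ⊎ (v ≡ c ⊎ v ≡ d)
  position c d v with <-cmp (toℕ v) (toℕ c) | <-cmp (toℕ v) (toℕ d)
  ... | tri< v<c _ _ | _ = inj₁ (false , inj₁ v<c)
  ... | tri≈ _ v≡c _ | _ = inj₂ (inj₁ (toℕ-injective v≡c))
  ... | tri> _ _ c<v | tri< v<d _ _ = inj₁ (true , c<v , v<d)
  ... | tri> _ _ _ | tri≈ _ v≡d _ = inj₂ (inj₂ (toℕ-injective v≡d))
  ... | tri> _ _ _ | tri> _ _ d<v = inj₁ (false , inj₂ d<v)

  faceHasEdge⇒∈ : ∀ (g : Face) {a b} → FaceHasEdge E g a b → a ∈ verts g × b ∈ verts g
  faceHasEdge⇒∈ g (inj₁ ab) = cycConsec⇒∈ ab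
  faceHasEdge⇒∈ g (inj₂ ba) = let b∈ , a∈ = cycConsec⇒∈ ba in a∈ , b∈

  closing-edge : ∀ (g : Face) {h l} → head (verts g) ≡ just h → last (verts g) ≡ just l → E h l
  closing-edge g h≡ l≡ = E-sym (boundary g (inj₂ (l≡ , h≡)))

  module _ (g : Face) {c d v : Fin n} (cd : E c d) (c<v : c <ᶠ v) (v<d : v <ᶠ d) (v∈ : v ∈ verts g) where

    chord-start-∈ : ∀ {h} → head (verts g) ≡ just h → h ≤ᶠ c → c ∈ verts g
    chord-start-∈ h≡ h≤c
      with consec-straddling (sorted g) (head⇒∈ h≡) v∈ (s≤s h≤c) c<v
    ... | a , b , ab , a≤c , c<b with consec-gap (sorted g) ab v∈
    ...   | inj₁ v≤a = contradiction (≤-trans v≤a (≤-pred a≤c)) (<⇒≱ c<v)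
    ...   | inj₂ b≤v with m≤n⇒m<n∨m≡n (≤-pred a≤c)
    ...     | inj₁ a<c = ⊥-elim (noCross (boundary g (inj₁ ab)) cd a<c c<b (≤-<-trans b≤v v<d))
    ...     | inj₂ a≡c = subst (_∈ verts g) (toℕ-injective a≡c) (proj₁ (consec⇒∈ ab))

    chord-end-∈ : ∀ {l} → last (verts g) ≡ just l → d ≤ᶠ l → d ∈ verts g
    chord-end-∈ l≡ d≤l
      with consec-straddling (sorted g) v∈ (last⇒∈ l≡) v<d d≤l
    ... | a , b , ab , a<d , d≤b with consec-gap (sorted g) ab v∈
    ...   | inj₂ b≤v = contradiction (<-≤-trans v<d d≤b) (≤⇒≯ b≤v)
    ...   | inj₁ v≤a with m≤n⇒m<n∨m≡n d≤b
    ...     | inj₁ d<b = ⊥-elim (noCross cd (boundary g (inj₁ ab)) (<-≤-trans c<v v≤a) a<d d<b)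
    ...     | inj₂ d≡b = subst (_∈ verts g) (toℕ-injective (sym d≡b)) (proj₂ (consec⇒∈ ab))

  -- Running along g from the inner vertex v, non-crossing forces g through c (resp. d), unless the
  -- closing edge {last, head} of g crosses the chord; and once c, d ∈ g, noChord makes {c, d} a side of g.
  face-inside-not-outside : ∀ (g : Face) {c d v w : Fin n} → c <ᶠ d → E c d →
    v ∈ verts g → Inside c d v → w ∈ verts g → ¬ Outside c d w
  face-inside-not-outside g {c} {d} {v} {w} c<d cd v∈ (c<v , v<d) w∈ w-out =
    let h , l , h≡ , l≡ , _ = ends (<⇒≤ (size g)) (sorted g) in by-ends h≡ l≡ (h F.≤? c) (d F.≤? l) w-out
    where
    s = sorted g
    side-of-g : c ∈ verts g → Outside c d w → CycConsec (verts g) c d ⊎ CycConsec (verts g) d c → ⊥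
    side-of-g _ _ (inj₁ (inj₁ cd-consec)) with consec-gap s cd-consec v∈
    ... | inj₁ v≤c = <⇒≱ c<v v≤c
    ... | inj₂ d≤v = <⇒≱ v<d d≤v
    side-of-g c∈ _ (inj₁ (inj₂ (_ , head≡d))) = <⇒≱ c<d (head≤ s head≡d c∈)
    side-of-g _ _ (inj₂ (inj₁ dc-consec)) = <-asym c<d (consec⇒< s dc-consec)
    side-of-g _ (inj₁ w<c) (inj₂ (inj₂ (_ , head≡c))) = <⇒≱ w<c (head≤ s head≡c w∈)
    side-of-g _ (inj₂ d<w) (inj₂ (inj₂ (last≡d , _))) = <⇒≱ d<w (≤last s last≡d w∈)
    by-ends : ∀ {h l} → head (verts g) ≡ just h → last (verts g) ≡ just l →
      Dec (h ≤ᶠ c) → Dec (d ≤ᶠ l) → Outside c d w → ⊥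
    by-ends h≡ l≡ (yes h≤c) (yes d≤l) w-out = side-of-g c∈ w-out (noChord g c∈ (chord-end-∈ g cd c<v v<d v∈ l≡ d≤l) cd)
      where c∈ = chord-start-∈ g cd c<v v<d v∈ h≡ h≤c
    by-ends h≡ l≡ (yes _) (no d≰l) (inj₁ w<c) =
      noCross (closing-edge g h≡ l≡) cd (≤-<-trans (head≤ s h≡ w∈) w<c) (<-≤-trans c<v (≤last s l≡ v∈)) (≰⇒> d≰l)
    by-ends h≡ l≡ (no h≰c) (yes _) (inj₂ d<w) =
      noCross cd (closing-edge g h≡ l≡) (≰⇒> h≰c) (≤-<-trans (head≤ s h≡ v∈) v<d) (<-≤-trans d<w (≤last s l≡ w∈))
    by-ends h≡ _ (no h≰c) _ (inj₁ w<c) = h≰c (≤-trans (head≤ s h≡ w∈) (<⇒≤ w<c))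
    by-ends _ l≡ _ (no d≰l) (inj₂ d<w) = d≰l (≤-trans (<⇒≤ d<w) (≤last s l≡ w∈))

  face-on-one-side : ∀ (g : Face) {c d v w : Fin n} {s t} → c <ᶠ d → E c d →
    v ∈ verts g → OnSide s c d v → w ∈ verts g → OnSide t c d w → s ≡ t
  face-on-one-side g {s = true} {true} _ _ _ _ _ _ = refl
  face-on-one-side g {s = false} {false} _ _ _ _ _ _ = refl
  face-on-one-side g {s = true} {false} c<d cd v∈ v-in w∈ w-out =
    ⊥-elim (face-inside-not-outside g c<d cd v∈ v-in w∈ w-out)
  face-on-one-side g {s = false} {true} c<d cd v∈ v-out w∈ w-in =
    ⊥-elim (face-inside-not-outside g c<d cd w∈ w-in v∈ v-out)

  inside? : ∀ c d v → Dec (Inside c d v)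
  inside? c d v = (c F.<? v) ×-dec (v F.<? d)

  insideᵇ : Fin n → Fin n → Face → Bool
  insideᵇ c d g = does (any? (inside? c d) (verts g))

  face-has-vertex-on-side : ∀ c d (g : Face) → ∃ λ v → v ∈ verts g × OnSide (insideᵇ c d g) c d v
  face-has-vertex-on-side c d g with insideᵇ c d g in e
  ... | true = find (does-true⇒ (any? (inside? c d) (verts g)) e)
  ... | false with third-element (size g) (sorted g) c d
  ...   | v , v∈ , v≢c , v≢d with position c d v
  ...     | inj₁ (true , v-in) = contradiction (lose v∈ v-in) (does-false⇒ (any? (inside? c d) (verts g)) e)
  ...     | inj₁ (false , v-out) = v , v∈ , v-out
  ...     | inj₂ (inj₁ v≡c) = contradiction v≡c v≢c
  ...     | inj₂ (inj₂ v≡d) = contradiction v≡d v≢d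

  onSide⇒insideᵇ : ∀ (g : Face) {c d v s} → c <ᶠ d → E c d → v ∈ verts g → OnSide s c d v → insideᵇ c d g ≡ s
  onSide⇒insideᵇ g {c} {d} {s = s} c<d cd v∈ v-side with face-has-vertex-on-side c d g
  ... | w , w∈ , w-side = face-on-one-side g {s = insideᵇ c d g} {s} c<d cd w∈ w-side v∈ v-side

  separating-edge : ∀ (h : Face) {x} → x ∉ verts h →
    ∃₂ λ c d → c <ᶠ d × E c d × c ∈ verts h × d ∈ verts h ×
      ∃ λ s → OnSide s c d x × (∀ {v} → v ∈ verts h → ¬ OnSide s c d v)
  separating-edge h {x} x∉ with ends (<⇒≤ (size h)) (sorted h)
  ... | first , l , first≡ , l≡ , first<l with position first l x
  ...   | inj₂ (inj₁ refl) = contradiction (head⇒∈ first≡) x∉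
  ...   | inj₂ (inj₂ refl) = contradiction (last⇒∈ l≡) x∉
  ...   | inj₁ (false , x-out) =
          first , l , first<l , closing-edge h first≡ l≡ , head⇒∈ first≡ , last⇒∈ l≡ , false , x-out , h-within
    where
    h-within : ∀ {v} → v ∈ verts h → ¬ Outside first l v
    h-within v∈ (inj₁ v<first) = <⇒≱ v<first (head≤ (sorted h) first≡ v∈)
    h-within v∈ (inj₂ l<v) = <⇒≱ l<v (≤last (sorted h) l≡ v∈)
  ...   | inj₁ (true , first<x , x<l)
          with consec-straddling (sorted h) (head⇒∈ first≡) (last⇒∈ l≡) first<x (<⇒≤ x<l)
  ...     | a , b , ab , a<x , x≤b with m≤n⇒m<n∨m≡n x≤b
  ...       | inj₂ x≡b = contradiction (subst (_∈ verts h) (sym (toℕ-injective x≡b)) (proj₂ (consec⇒∈ ab))) x∉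
  ...       | inj₁ x<b =
              a , b , consec⇒< (sorted h) ab , boundary h (inj₁ ab) , proj₁ (consec⇒∈ ab) , proj₂ (consec⇒∈ ab) ,
              true , (a<x , x<b) , h-outside
    where
    h-outside : ∀ {v} → v ∈ verts h → ¬ Inside a b v
    h-outside v∈ (a<v , v<b) with consec-gap (sorted h) ab v∈
    ... | inj₁ v≤a = <⇒≱ a<v v≤a
    ... | inj₂ b≤v = <⇒≱ v<b b≤v

  off-side-endpoint : ∀ (g h : Face) {c d x z s} → c <ᶠ d → E c d → x ∈ verts g → OnSide s c d x →
    (∀ {v} → v ∈ verts h → ¬ OnSide s c d v) → z ∈ verts g → z ∈ verts h → z ≡ c ⊎ z ≡ d
  off-side-endpoint g h {c} {d} {z = z} {s} c<d cd x∈g x-side h-off z∈g z∈h with position c d z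
  ... | inj₂ z-end = z-end
  ... | inj₁ (t , z-side) = ⊥-elim (h-off z∈h (subst (λ s → OnSide s c d z) (sym s≡t) z-side))
    where s≡t = face-on-one-side g {s = s} {t} c<d cd x∈g x-side z∈g z-side

  face-⊆ : ∀ (g h : Face) {c d} → c <ᶠ d → E c d → c ∈ verts g → d ∈ verts g → c ∈ verts h → d ∈ verts h →
    insideᵇ c d g ≡ insideᵇ c d h → ∀ {x} → x ∈ verts g → x ∈ verts h
  face-⊆ g h {c} {d} c<d cd c∈g d∈g c∈h d∈h same {x} x∈g with x ∈? verts h
  ... | yes x∈h = x∈h
  ... | no x∉h with separating-edge h x∉h
  ...   | c′ , d′ , c′<d′ , c′d′ , _ , _ , s , x-side , h-off
          with SameEdge-ordered c′<d′ c<d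
                 (endpoints⇒SameEdge (off-side-endpoint g h {s = s} c′<d′ c′d′ x∈g x-side h-off c∈g c∈h)
                                     (off-side-endpoint g h {s = s} c′<d′ c′d′ x∈g x-side h-off d∈g d∈h)
                                     (<⇒≢ c<d ∘′ cong toℕ))
  ...     | refl , refl with face-has-vertex-on-side c d h
  ...       | w , w∈h , w-side = ⊥-elim (h-off w∈h (subst (λ t → OnSide t c d w) h≡s w-side))
    where h≡s = trans (sym same) (onSide⇒insideᵇ g {s = s} c<d cd x∈g x-side)

  face-unique : ∀ (g h : Face) {c d} → c <ᶠ d → E c d → c ∈ verts g → d ∈ verts g → c ∈ verts h → d ∈ verts h →
    insideᵇ c d g ≡ insideᵇ c d h → verts g ≡ verts h
  face-unique g h c<d cd c∈g d∈g c∈h d∈h same =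
    sorted-ext (sorted g) (sorted h) (face-⊆ g h c<d cd c∈g d∈g c∈h d∈h same)
                                     (face-⊆ h g c<d cd c∈h d∈h c∈g d∈g (sym same))

  dualEdge-∈ : ∀ {g h : Face} (δ : DualEdge E g h) {c d} → SameEdge c d (ea δ) (ebb δ) →
    (c ∈ verts g × d ∈ verts g) × (c ∈ verts h × d ∈ verts h)
  dualEdge-∈ {g} {h} δ cd≈δ =
    SameEdge-resp (λ a b → a ∈ verts g × b ∈ verts g) swap cd≈δ (faceHasEdge⇒∈ g (inF δ)) ,
    SameEdge-resp (λ a b → a ∈ verts h × b ∈ verts h) swap cd≈δ (faceHasEdge⇒∈ h (inG δ))

  dualEdge-flips : ∀ {g h : Face} (δ : DualEdge E g h) {c d} → c <ᶠ d → E c d →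
    SameEdge c d (ea δ) (ebb δ) → insideᵇ c d g ≡ not (insideᵇ c d h)
  dualEdge-flips {g} {h} δ c<d cd cd≈δ with dualEdge-∈ δ cd≈δ
  ... | (c∈g , d∈g) , (c∈h , d∈h) = ¬-not (λ same → distinct δ (face-unique g h c<d cd c∈g d∈g c∈h d∈h same))

  dualEdge-preserves : ∀ {g h : Face} (δ : DualEdge E g h) {c d} → c <ᶠ d → E c d →
    ¬ SameEdge c d (ea δ) (ebb δ) → insideᵇ c d g ≡ insideᵇ c d h
  dualEdge-preserves {g} {h} δ {c} {d} c<d cd cd≉δ
    with insideᵇ c d g ≟ᵇ insideᵇ c d h | face-has-vertex-on-side c d g
  ... | yes same | _ = same
  ... | no differ | x , x∈g , x-side = ⊥-elim (cd≉δ (endpoints⇒SameEdge (shared (proj₁ δ∈g) (proj₁ δ∈h))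
                                                     (shared (proj₂ δ∈g) (proj₂ δ∈h)) ea≢eb))
    where
    δ∈g = faceHasEdge⇒∈ g (inF δ)
    δ∈h = faceHasEdge⇒∈ h (inG δ)
    ea≢eb : ea δ ≢ ebb δ
    ea≢eb ea≡eb = irrefl (subst (E (ea δ)) (sym ea≡eb) (proj₁ (inner δ)))
    h-off : ∀ {v} → v ∈ verts h → ¬ OnSide (insideᵇ c d g) c d v
    h-off v∈h v-side = differ (sym (onSide⇒insideᵇ h c<d cd v∈h v-side))
    shared : ∀ {z} → z ∈ verts g → z ∈ verts h → z ≡ c ⊎ z ≡ d
    shared = off-side-endpoint g h {s = insideᵇ c d g} c<d cd x∈g x-side h-off

  walk-start : ∀ {g h : Face} (w : DualWalk E g h) → verts g ∈ map verts (walkFaces E w)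
  walk-start [] = here refl
  walk-start (_ ∷ _) = here refl

  onWalk⇒face-on-side : ∀ {g h : Face} (w : DualWalk E g h) {c d} → c <ᶠ d → E c d → OnWalk E w c d →
    ∀ s → ∃ λ (k : Face) → verts k ∈ map verts (walkFaces E w) × (c ∈ verts k × d ∈ verts k) × insideᵇ c d k ≡ s
  onWalk⇒face-on-side {g} (_∷_ {g = g′} δ w) {c} {d} c<d cd (inj₁ cd≈δ) s with insideᵇ c d g ≟ᵇ s
  ... | yes g-s = g , here refl , proj₁ (dualEdge-∈ δ cd≈δ) , g-s
  ... | no g≢s = g′ , there (walk-start w) , proj₂ (dualEdge-∈ δ cd≈δ) ,
                 not-injective (trans (sym (dualEdge-flips δ c<d cd cd≈δ)) (¬-not g≢s))
  onWalk⇒face-on-side (δ ∷ w) c<d cd (inj₂ on-w) s with onWalk⇒face-on-side w c<d cd on-w s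
  ... | k , k∈w , rest = k , there k∈w , rest

  sameEdge? : ∀ (u v a b : Fin n) → Dec (SameEdge u v a b)
  sameEdge? u v a b = ((u F.≟ a) ×-dec (v F.≟ b)) ⊎-dec ((u F.≟ b) ×-dec (v F.≟ a))

  -- A path never revisits g, and by face-unique every face through the chord on g's side is g.
  path-crosses-chord : ∀ {g h : Face} (p : DualWalk E g h) → IsPath E p → ∀ {c d} → c <ᶠ d → E c d →
    OnWalk E p c d ⇔ (insideᵇ c d g xor insideᵇ c d h ≡ true)
  path-crosses-chord {g} [] _ {c} {d} _ _ =
    mk⇔ (λ ()) (λ e → contradiction (trans (sym e) (xor-same (insideᵇ c d g))) λ ())
  path-crosses-chord {g} {h} (_∷_ {g = g′} δ w) (g∉w ∷ w-path) {c} {d} c<d cd with sameEdge? c d (ea δ) (ebb δ)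
  ... | yes cd≈δ = mk⇔ (λ _ → separated) (λ _ → inj₁ cd≈δ)
    where
    not-on-w : ¬ OnWalk E w c d
    not-on-w on-w with onWalk⇒face-on-side w c<d cd on-w (insideᵇ c d g)
    ... | k , k∈w , (c∈k , d∈k) , k-side with proj₁ (dualEdge-∈ δ cd≈δ)
    ...   | c∈g , d∈g = All.lookup g∉w k∈w (face-unique g k c<d cd c∈g d∈g c∈k d∈k (sym k-side))
    g′≡h : insideᵇ c d g′ ≡ insideᵇ c d h
    g′≡h = xor≢true⇒≡ (not-on-w ∘′ from (path-crosses-chord w w-path c<d cd))
    separated : insideᵇ c d g xor insideᵇ c d h ≡ true
    separated = begin
      insideᵇ c d g xor insideᵇ c d h             ≡⟨ cong₂ _xor_ (dualEdge-flips δ c<d cd cd≈δ) (sym g′≡h) ⟩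
      not (insideᵇ c d g′) xor insideᵇ c d g′     ≡⟨ xor-inverseˡ (insideᵇ c d g′) ⟩
      true                                        ∎
      where open ≡-Reasoning
  ... | no cd≉δ = mk⇔ (λ { (inj₁ cd≈δ) → contradiction cd≈δ cd≉δ ; (inj₂ on-w) → subst Separated (sym same) (to ih on-w) })
                      (λ e → inj₂ (from ih (subst Separated same e)))
    where
    ih = path-crosses-chord w w-path c<d cd
    same = dualEdge-preserves δ c<d cd cd≉δ
    Separated : Bool → Set
    Separated b = b xor insideᵇ c d h ≡ true

  outer-edge-inside-vertex : ∀ (g : Face) {w} → FaceHasEdge E g w (cnext w) → ∀ {c d} → d ≢ cnext c →
    c ≤ᶠ w → suc (toℕ w) ≤ toℕ d → ∃ λ v → v ∈ verts g × Inside c d v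
  outer-edge-inside-vertex g {w} w∈g {d = d} d≢c+1 c≤w w<d with faceHasEdge⇒∈ g w∈g | m≤n⇒m<n∨m≡n c≤w
  ... | w∈ , _ | inj₁ c<w = w , w∈ , c<w , w<d
  ... | _ , w+1∈ | inj₂ c≡w with toℕ-injective c≡w | cnext-view w
  ...   | refl | inj₁ (w+1≡ , _) =
          cnext w , w+1∈ , subst (toℕ w <_) (sym w+1≡) ≤-refl ,
          subst (_< _) (sym w+1≡) (≤∧≢⇒< w<d (λ w+1≡d → d≢c+1 (toℕ-injective (trans (sym w+1≡d) (sym w+1≡)))))
  ...   | refl | inj₂ (_ , w+1≡n) = contradiction (subst (_≤ toℕ d) w+1≡n w<d) (<⇒≱ (toℕ<n d))

  outer-edge-outside-vertex : ∀ (g : Face) {w} → FaceHasEdge E g w (cnext w) → ∀ {c d} → c ≢ cnext d →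
    d ≤ᶠ w → ∃ λ v → v ∈ verts g × Outside c d v
  outer-edge-outside-vertex g {w} w∈g {c} c≢d+1 d≤w with faceHasEdge⇒∈ g w∈g | m≤n⇒m<n∨m≡n d≤w
  ... | w∈ , _ | inj₁ d<w = w , w∈ , inj₂ d<w
  ... | _ , w+1∈ | inj₂ d≡w with toℕ-injective d≡w | cnext-view w
  ...   | refl | inj₁ (w+1≡ , _) = cnext w , w+1∈ , inj₂ (subst (toℕ w <_) (sym w+1≡) ≤-refl)
  ...   | refl | inj₂ (w+1≡0 , _) =
          cnext w , w+1∈ , inj₁ (subst (_< toℕ c) (sym w+1≡0)
                                       (n≢0⇒n>0 (λ c≡0 → c≢d+1 (toℕ-injective (trans c≡0 (sym w+1≡0))))))

  face-at-outer-edge-side : ∀ (g : Face) {w} → FaceHasEdge E g w (cnext w) →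
    ∀ {c d} → c <ᶠ d → InnerEdge E c d → insideᵇ c d g ≡ crosses (suc (toℕ w)) (toℕ c) (toℕ d)
  face-at-outer-edge-side g {w} w∈g {c} {d} c<d (cd , d≢c+1 , c≢d+1) with toℕ c ≤? toℕ w | suc (toℕ w) ≤? toℕ d
  ... | no c≰w | _ =
        trans (onSide⇒insideᵇ g c<d cd (proj₁ (faceHasEdge⇒∈ g w∈g)) (inj₁ (≰⇒> c≰w)))
              (sym (crosses-false-≤ (≰⇒> c≰w) (<⇒≤ c<d)))
  ... | yes c≤w | yes w<d =
        let v , v∈ , v-in = outer-edge-inside-vertex g w∈g d≢c+1 c≤w w<d
        in trans (onSide⇒insideᵇ g c<d cd v∈ v-in) (sym (crosses-true (s≤s c≤w) w<d))
  ... | yes c≤w | no w≮d =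
        let v , v∈ , v-out = outer-edge-outside-vertex g w∈g c≢d+1 (≤-pred (≰⇒> w≮d))
        in trans (onSide⇒insideᵇ g c<d cd v∈ v-out) (sym (crosses-false-> (≰⇒> w≮d) (<⇒≤ c<d)))

  face-within : ∀ (g : Face) {c d z} → c <ᶠ d → E c d → insideᵇ c d g ≡ true → z ∈ verts g → c ≤ᶠ z × z ≤ᶠ d
  face-within g c<d cd e z∈ = ≮⇒≥ (λ z<c → not-outside (inj₁ z<c)) , ≮⇒≥ (λ d<z → not-outside (inj₂ d<z))
    where
    not-outside : ¬ Outside _ _ _
    not-outside z-out = contradiction (trans (sym e) (onSide⇒insideᵇ g {s = false} c<d cd z∈ z-out)) λ ()

  face-without : ∀ (g : Face) {c d z} → c <ᶠ d → E c d → insideᵇ c d g ≡ false → z ∈ verts g → z ≤ᶠ c ⊎ d ≤ᶠ z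
  face-without g {c} {d} {z} c<d cd e z∈ with toℕ z ≤? toℕ c | toℕ d ≤? toℕ z
  ... | yes z≤c | _ = inj₁ z≤c
  ... | no _ | yes d≤z = inj₂ d≤z
  ... | no z≰c | no d≰z =
        contradiction (trans (sym e) (onSide⇒insideᵇ g {s = true} c<d cd z∈ (≰⇒> z≰c , ≰⇒> d≰z))) λ ()

  InnerEdge-sym : ∀ {u v} → InnerEdge E u v → InnerEdge E v u
  InnerEdge-sym (uv , v≢u+1 , u≢v+1) = E-sym uv , u≢v+1 , v≢u+1

  OnWalk-sym : ∀ {g h : Face} (p : DualWalk E g h) {u v} → OnWalk E p u v → OnWalk E p v u
  OnWalk-sym (δ ∷ p) (inj₁ uv≈δ) = inj₁ (SameEdge-swap uv≈δ)
  OnWalk-sym (δ ∷ p) (inj₂ on-p) = inj₂ (OnWalk-sym p on-p)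

  OnWalk⇒InnerEdge : ∀ {g h : Face} (p : DualWalk E g h) {u v} → OnWalk E p u v → InnerEdge E u v
  OnWalk⇒InnerEdge (δ ∷ p) (inj₁ uv≈δ) = SameEdge-resp (InnerEdge E) InnerEdge-sym uv≈δ (inner δ)
  OnWalk⇒InnerEdge (δ ∷ p) (inj₂ on-p) = OnWalk⇒InnerEdge p on-p

  wlog-ordered : ∀ (P Q : Fin n → Fin n → Set) → (∀ {a b} → P a b → P b a) → (∀ {a b} → Q a b → Q b a) →
    (∀ {c d} → c <ᶠ d → InnerEdge E c d → P c d → Q c d) → ∀ {u v} → InnerEdge E u v → P u v → Q u v
  wlog-ordered P Q P-sym Q-sym P⇒Q {u} {v} uv@(E-uv , _ , _) Puv with <-cmp (toℕ u) (toℕ v)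
  ... | tri< u<v _ _ = P⇒Q u<v uv Puv
  ... | tri≈ _ u≡v _ = ⊥-elim (irrefl (subst (E u) (sym (toℕ-injective u≡v)) E-uv))
  ... | tri> _ _ v<u = Q-sym (P⇒Q v<u (InnerEdge-sym uv) (P-sym Puv))

  module Cut (i j : Fin n) (i≢j+1 : i ≢ cnext j) {f₁ f₂ : Face}
             (f₁-edge : FaceHasEdge E f₁ (cprev i) i) (f₂-edge : FaceHasEdge E f₂ j (cnext j)) where

    S : Fin n → Set
    S = CycInt i j

    BoundaryEdge : Fin n → Fin n → Set
    BoundaryEdge u v = SameEdge u v (cprev i) i ⊎ SameEdge u v j (cnext j)

    InCut-sym : ∀ {u v} → InCut E S u v → InCut E S v u
    InCut-sym (uv , inj₁ u-in) = E-sym uv , inj₂ u-in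
    InCut-sym (uv , inj₂ v-in) = E-sym uv , inj₁ v-in

    ∉S⇒cycIntᵇ : ∀ {v} → ¬ S v → cycIntᵇ i j v ≡ false
    ∉S⇒cycIntᵇ v∉ = ¬-not (v∉ ∘′ cycIntᵇ⇒cycInt)

    inCut⇔ : ∀ {u v} → E u v → InCut E S u v ⇔ (cycIntᵇ i j u xor cycIntᵇ i j v ≡ true)
    inCut⇔ {u} {v} uv = mk⇔ forward backward
      where
      forward : InCut E S u v → cycIntᵇ i j u xor cycIntᵇ i j v ≡ true
      forward (_ , inj₁ (u∈ , v∉)) = cong₂ _xor_ (cycInt⇒cycIntᵇ u∈) (∉S⇒cycIntᵇ v∉)
      forward (_ , inj₂ (v∈ , u∉)) = cong₂ _xor_ (∉S⇒cycIntᵇ u∉) (cycInt⇒cycIntᵇ v∈)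
      backward : cycIntᵇ i j u xor cycIntᵇ i j v ≡ true → InCut E S u v
      backward e with cycIntᵇ i j u in eu | cycIntᵇ i j v in ev
      ... | true | false = uv , inj₁ (cycIntᵇ⇒cycInt eu , λ v∈ → not-¬ (cycInt⇒cycIntᵇ v∈) ev)
      ... | false | true = uv , inj₂ (cycIntᵇ⇒cycInt ev , λ u∈ → not-¬ (cycInt⇒cycIntᵇ u∈) eu)

    f₁-side : ∀ {c d} → c <ᶠ d → InnerEdge E c d → insideᵇ c d f₁ ≡ crosses (toℕ i) (toℕ c) (toℕ d)
    f₁-side {c} {d} c<d cd = trans (face-at-outer-edge-side f₁ f₁-edge′ c<d cd) (threshold (cprev-view i))
      where
      f₁-edge′ = subst (FaceHasEdge E f₁ (cprev i)) (sym (cnext-cprev i)) f₁-edge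
      -- for i = 0 the face f₁ sits at the outer edge {n-1, 0}, whose threshold n lies above every chord
      threshold : suc (toℕ (cprev i)) ≡ toℕ i ⊎ (toℕ i ≡ 0 × suc (toℕ (cprev i)) ≡ n) →
        crosses (suc (toℕ (cprev i))) (toℕ c) (toℕ d) ≡ crosses (toℕ i) (toℕ c) (toℕ d)
      threshold (inj₁ i≡) = cong (λ t → crosses t (toℕ c) (toℕ d)) i≡
      threshold (inj₂ (i≡0 , i-1+1≡n)) =
        trans (crosses-false-> (subst (toℕ d <_) (sym i-1+1≡n) (toℕ<n d)) (<⇒≤ c<d))
              (sym (crosses-false-≤ (subst (_≤ toℕ c) (sym i≡0) z≤n) (<⇒≤ c<d)))

    cut-parity : ∀ {c d} → c <ᶠ d → InnerEdge E c d →
      cycIntᵇ i j c xor cycIntᵇ i j d ≡ insideᵇ c d f₁ xor insideᵇ c d f₂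
    cut-parity {c} {d} c<d cd = trans (cycIntᵇ-xor i j c d)
                              (sym (cong₂ _xor_ (f₁-side c<d cd) (face-at-outer-edge-side f₂ f₂-edge c<d cd)))

    chord-cut⇔ : ∀ {c d} → c <ᶠ d → InnerEdge E c d → InCut E S c d ⇔ (insideᵇ c d f₁ xor insideᵇ c d f₂ ≡ true)
    chord-cut⇔ c<d cd = mk⇔ (λ cut → trans (sym (cut-parity c<d cd)) (to (inCut⇔ (proj₁ cd)) cut))
                            (λ e → from (inCut⇔ (proj₁ cd)) (trans (cut-parity c<d cd) e))

    boundary⇒cut : ∀ {u v} → BoundaryEdge u v → InCut E S u v
    boundary⇒cut (inj₁ uv≈) = SameEdge-resp (InCut E S) InCut-sym uv≈
      (subst (E (cprev i)) (cnext-cprev i) (outer (cprev i)) ,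
       inj₂ (cycInt-start i j , cycInt-disjoint i≢j+1 (cycInt-end (cnext j) (cprev i))))
    boundary⇒cut (inj₂ uv≈) = SameEdge-resp (InCut E S) InCut-sym uv≈
      (outer j , inj₁ (cycInt-end i j , cycInt-disjoint i≢j+1 (cycInt-start (cnext j) (cprev i))))

    outer-cut⇒boundary : ∀ u → InCut E S u (cnext u) → BoundaryEdge u (cnext u)
    outer-cut⇒boundary u cut with cycIntᵇ-step i j u (to (inCut⇔ (proj₁ cut)) cut)
    ... | inj₁ refl = inj₁ (inj₁ (refl , cnext-cprev i))
    ... | inj₂ refl = inj₂ (inj₁ (refl , refl))

    cut-classify : ∀ {u v} → InCut E S u v → BoundaryEdge u v ⊎ InnerEdge E u v
    cut-classify {u} {v} cut with v F.≟ cnext u | u F.≟ cnext v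
    ... | yes refl | _ = inj₁ (outer-cut⇒boundary u cut)
    ... | no _ | yes refl = inj₁ (Data.Sum.map SameEdge-swap SameEdge-swap (outer-cut⇒boundary v (InCut-sym cut)))
    ... | no v≢u+1 | no u≢v+1 = inj₂ (proj₁ cut , v≢u+1 , u≢v+1)

    cut-as-path : (p : DualWalk E f₁ f₂) → IsPath E p →
      ∀ u v → InCut E S u v ⇔ (OnWalk E p u v ⊎ BoundaryEdge u v)
    cut-as-path p p-path u v = mk⇔ forward backward
      where
      chord-on-p⇔cut : ∀ {c d} → c <ᶠ d → InnerEdge E c d → OnWalk E p c d ⇔ InCut E S c d
      chord-on-p⇔cut c<d cd =
        mk⇔ (from (chord-cut⇔ c<d cd) ∘′ to (path-crosses-chord p p-path c<d (proj₁ cd)))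
            (from (path-crosses-chord p p-path c<d (proj₁ cd)) ∘′ to (chord-cut⇔ c<d cd))
      forward : InCut E S u v → OnWalk E p u v ⊎ BoundaryEdge u v
      forward cut with cut-classify cut
      ... | inj₁ boundary = inj₂ boundary
      ... | inj₂ uv = inj₁ (wlog-ordered (InCut E S) (OnWalk E p) InCut-sym (OnWalk-sym p)
                              (λ c<d cd → from (chord-on-p⇔cut c<d cd)) uv cut)
      backward : OnWalk E p u v ⊎ BoundaryEdge u v → InCut E S u v
      backward (inj₁ on-p) = wlog-ordered (OnWalk E p) (InCut E S) (OnWalk-sym p) InCut-sym
                               (λ c<d cd → to (chord-on-p⇔cut c<d cd)) (OnWalk⇒InnerEdge p on-p) on-p
      backward (inj₂ boundary) = boundary⇒cut boundary

    -- f lies on the far side of the chord from both {i-1, i} and {j, j+1}, so between two vertices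
    -- of f the thresholds i and j+1 are crossed alike.
    face-beyond-chord-uncut : ∀ (f : Face) {c d x y} → c <ᶠ d → InnerEdge E c d →
      insideᵇ c d f₁ ≡ insideᵇ c d f₂ → insideᵇ c d f ≢ insideᵇ c d f₁ →
      x ∈ verts f → y ∈ verts f → x ≤ᶠ y → cycIntᵇ i j x ≡ cycIntᵇ i j y
    face-beyond-chord-uncut f {c} {d} {x} {y} c<d cd f₁≡f₂ f≢f₁ x∈ y∈ x≤y = xor≡false⇒≡ (begin
      cycIntᵇ i j x xor cycIntᵇ i j y              ≡⟨ cycIntᵇ-xor i j x y ⟩
      cross (toℕ i) xor cross (suc (toℕ j))        ≡⟨ cong (_xor cross (suc (toℕ j))) same-crossing ⟩
      cross (suc (toℕ j)) xor cross (suc (toℕ j))  ≡⟨ xor-same (cross (suc (toℕ j))) ⟩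
      false                                        ∎)
      where
      open ≡-Reasoning
      cross : ℕ → Bool
      cross t = crosses t (toℕ x) (toℕ y)
      f₂-side = face-at-outer-edge-side f₂ f₂-edge c<d cd
      same-crossing : crosses (toℕ i) (toℕ x) (toℕ y) ≡ crosses (suc (toℕ j)) (toℕ x) (toℕ y)
      same-crossing with insideᵇ c d f in f-side
      ... | true = trans (crosses-false-within {toℕ i} i-below-or-above c≤x x≤y y≤d)
                         (sym (crosses-false-within {suc (toℕ j)} j-below-or-above c≤x x≤y y≤d))
        where
        f₁-outside : insideᵇ c d f₁ ≡ false
        f₁-outside = ¬-not (f≢f₁ ∘′ sym)
        i-below-or-above = trans (sym (f₁-side c<d cd)) f₁-outside
        j-below-or-above = trans (sym f₂-side) (trans (sym f₁≡f₂) f₁-outside)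
        c≤x = proj₁ (face-within f c<d (proj₁ cd) f-side x∈)
        y≤d = proj₂ (face-within f c<d (proj₁ cd) f-side y∈)
      ... | false = trans (crosses-outside {toℕ i} c<i i≤d x-out y-out)
                          (sym (crosses-outside {suc (toℕ j)} c<j j≤d x-out y-out))
        where
        f₁-inside : insideᵇ c d f₁ ≡ true
        f₁-inside = ¬-not (f≢f₁ ∘′ sym)
        i-between = crosses-true⇒ {toℕ i} (<⇒≤ c<d) (trans (sym (f₁-side c<d cd)) f₁-inside)
        j-between = crosses-true⇒ {suc (toℕ j)} (<⇒≤ c<d) (trans (sym f₂-side) (trans (sym f₁≡f₂) f₁-inside))
        c<i = proj₁ i-between ; i≤d = proj₂ i-between
        c<j = proj₁ j-between ; j≤d = proj₂ j-between
        x-out = face-without f c<d (proj₁ cd) f-side x∈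
        y-out = face-without f c<d (proj₁ cd) f-side y∈

    straddling-face-separates : ∀ {f : Face} → (Σ (Fin n) λ x → x ∈ verts f × CycInt i j x) →
      (Σ (Fin n) λ y → y ∈ verts f × CycInt (cnext j) (cprev i) y) →
      ∀ {c d} → c <ᶠ d → InnerEdge E c d →
      insideᵇ c d f₁ xor insideᵇ c d f ≡ true ⊎ insideᵇ c d f xor insideᵇ c d f₂ ≡ true →
      insideᵇ c d f₁ xor insideᵇ c d f₂ ≡ true
    straddling-face-separates {f} (x , x∈f , x∈S) (y , y∈f , y∈S̄) {c} {d} c<d cd separates-f
      with insideᵇ c d f₁ xor insideᵇ c d f₂ ≟ᵇ true
    ... | yes f₁-f₂-separated = f₁-f₂-separated
    ... | no ¬separated =
          contradiction (trans (sym (cycInt⇒cycIntᵇ x∈S)) (trans x≡y (∉S⇒cycIntᵇ (cycInt-disjoint i≢j+1 y∈S̄)))) λ ()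
      where
      f₁≡f₂ = xor≢true⇒≡ ¬separated
      f≢f₁ : insideᵇ c d f ≢ insideᵇ c d f₁
      f≢f₁ f≡f₁ = [ (λ e → xor≡true⇒≢ e (sym f≡f₁)) , (λ e → xor≡true⇒≢ e (trans f≡f₁ f₁≡f₂)) ] separates-f
      x≡y : cycIntᵇ i j x ≡ cycIntᵇ i j y
      x≡y with ≤-total (toℕ x) (toℕ y)
      ... | inj₁ x≤y = face-beyond-chord-uncut f c<d cd f₁≡f₂ f≢f₁ x∈f y∈f x≤y
      ... | inj₂ y≤x = sym (face-beyond-chord-uncut f c<d cd f₁≡f₂ f≢f₁ y∈f x∈f y≤x)

    module _ {f : Face} (p : DualWalk E f₁ f) (q : DualWalk E f f₂) (p-path : IsPath E p) (q-path : IsPath E q) where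

      cut⊆two-paths : ∀ u v → InCut E S u v → OnWalk E p u v ⊎ OnWalk E q u v ⊎ BoundaryEdge u v
      cut⊆two-paths u v cut with cut-classify cut
      ... | inj₁ boundary = inj₂ (inj₂ boundary)
      ... | inj₂ uv = [ inj₁ , inj₂ ∘′ inj₁ ]
                        (wlog-ordered (InCut E S) (λ a b → OnWalk E p a b ⊎ OnWalk E q a b) InCut-sym
                           (Data.Sum.map (OnWalk-sym p) (OnWalk-sym q)) chord-on-p-or-q uv cut)
        where
        chord-on-p-or-q : ∀ {c d} → c <ᶠ d → InnerEdge E c d → InCut E S c d → OnWalk E p c d ⊎ OnWalk E q c d
        chord-on-p-or-q {c} {d} c<d cd cut =
          Data.Sum.map (from (path-crosses-chord p p-path c<d (proj₁ cd)))
                       (from (path-crosses-chord q q-path c<d (proj₁ cd)))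
                       (xor-split {insideᵇ c d f₁} (insideᵇ c d f) (to (chord-cut⇔ c<d cd) cut))

      cut-as-two-paths : (Σ (Fin n) λ x → x ∈ verts f × CycInt i j x) →
        (Σ (Fin n) λ y → y ∈ verts f × CycInt (cnext j) (cprev i) y) →
        ∀ u v → InCut E S u v ⇔ (OnWalk E p u v ⊎ OnWalk E q u v ⊎ BoundaryEdge u v)
      cut-as-two-paths x-in y-out u v = mk⇔ (cut⊆two-paths u v) backward
        where
        chord-cut : ∀ {c d} → c <ᶠ d → InnerEdge E c d →
          insideᵇ c d f₁ xor insideᵇ c d f ≡ true ⊎ insideᵇ c d f xor insideᵇ c d f₂ ≡ true → InCut E S c d
        chord-cut c<d cd = from (chord-cut⇔ c<d cd) ∘′ straddling-face-separates {f} x-in y-out c<d cd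
        backward : OnWalk E p u v ⊎ OnWalk E q u v ⊎ BoundaryEdge u v → InCut E S u v
        backward (inj₁ on-p) = wlog-ordered (OnWalk E p) (InCut E S) (OnWalk-sym p) InCut-sym
          (λ c<d cd → chord-cut c<d cd ∘′ inj₁ ∘′ to (path-crosses-chord p p-path c<d (proj₁ cd)))
          (OnWalk⇒InnerEdge p on-p) on-p
        backward (inj₂ (inj₁ on-q)) = wlog-ordered (OnWalk E q) (InCut E S) (OnWalk-sym q) InCut-sym
          (λ c<d cd → chord-cut c<d cd ∘′ inj₂ ∘′ to (path-crosses-chord q q-path c<d (proj₁ cd)))
          (OnWalk⇒InnerEdge q on-q) on-q
        backward (inj₂ (inj₂ boundary)) = boundary⇒cut boundary

mainTheorem4 : (n : ℕ) (E : Fin n → Fin n → Set) → OuterplanarCycleEmbedded n E →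
  (i j : Fin n) → i ≢ cnext j →
  (f f₁ f₂ : BoundedFace E) →
  FaceHasEdge E f₁ (cprev i) i → FaceHasEdge E f₂ j (cnext j) →
  -- (a)
  ((p : DualWalk E f₁ f₂) → IsPath E p →
    ∀ u v → InCut E (CycInt i j) u v ⇔
      (OnWalk E p u v ⊎ SameEdge u v (cprev i) i ⊎ SameEdge u v j (cnext j)))
  ×
  -- (b)
  ((p : DualWalk E f₁ f) (q : DualWalk E f f₂) → IsPath E p → IsPath E q →
    ∀ u v → InCut E (CycInt i j) u v →
      OnWalk E p u v ⊎ OnWalk E q u v ⊎ SameEdge u v (cprev i) i ⊎ SameEdge u v j (cnext j))
  ×
  -- (c)
  ((p : DualWalk E f₁ f) (q : DualWalk E f f₂) → IsPath E p → IsPath E q →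
    Σ (Fin n) (λ x → x ∈ verts f × CycInt i j x) →
    Σ (Fin n) (λ y → y ∈ verts f × CycInt (cnext j) (cprev i) y) →
    ∀ u v → InCut E (CycInt i j) u v ⇔
      (OnWalk E p u v ⊎ OnWalk E q u v ⊎ SameEdge u v (cprev i) i ⊎ SameEdge u v j (cnext j)))
mainTheorem4 n E G i j i≢j+1 f f₁ f₂ f₁-edge f₂-edge =
  cut-as-path , cut⊆two-paths , cut-as-two-paths
  where open Dissection.Cut G i j i≢j+1 f₁-edge f₂-edge
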